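{- Let $q$ be a prime power. Let $\ell=(z,x,y)^\perp$ and $m=(\bar z,\bar x,\bar y)^\perp$ be two non-tangent lines of $\mathcal O$ in $\mathrm{PG}(2,q)$, and write $\Delta=\Delta(\ell)$ and $\bar\Delta=\Delta(m)$. Then: - if $q$ is even, $$\hat\rho(\ell,m)=\frac{(x\bar y+\bar xy)^2+(x\bar z+\bar xz)(y\bar z+\bar yz)}{z^2\bar z^2}=\sigma\!\left(\frac{x\bar y+\bar xy}{z\bar z}\right)+\Delta+\bar\Delta;$$ - if $q$ is odd, $$\hat\rho(\ell,m)=\frac{(2x\bar y+2\bar xy-z\bar z)^2\Delta\bar\Delta}{4}=\sigma\!\left(x\bar y+\bar xy-\frac{z\bar z}{2}\right)\Delta\bar\Delta.$$
   Context: Let $q$ be a prime power. Projective plane and conic. - Points are nonzero column vectors $(X,Y,Z)^\top$ up to scalars, and $(a,b,c)^\perp$ is the line $aX+bY+cZ=0$. - $\mathrm{PG}(2,q)\subset\mathrm{PG}(2,q^2)$. - $P_\xi=(\xi,\xi^2,1)^\top$ and $P_\infty=(0,1,0)^\top$. - $\mathcal O_{q^2}=\{P_\xi:\xi\in\mathbb F_{q^2}\cup\{\infty\}\}$, and $\mathcal O=\{P_\xi:\xi\in\mathbb F_q\cup\{\infty\}\}$. - A non-tangent line of $\mathrm{PG}(2,q)$ meets $\mathcal O$ in $0$ or $2$ points; viewed in $\mathrm{PG}(2,q^2)$ it meets $\mathcal O_{q^2}$ in two points. Cross-ratio. - With $v_x=(x,1)^\top$ and $v_\infty=(1,0)^\top$,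 $\rho(\alpha,\beta,\gamma,\delta)$ (no three equal) is the point $(\det(v_\alpha,v_\gamma)\det(v_\beta,v_\delta),\ \det(v_\alpha,v_\delta)\det(v_\beta,v_\gamma))^\top$ of $\mathrm{PG}(1,q^2)=\mathbb F_{q^2}\cup\{\infty\}$. For finite entries this equals $\frac{(\alpha-\gamma)(\beta-\delta)}{(\alpha-\delta)(\beta-\gamma)}$. The function $f$ on $\mathbb F_{q^2}\cup\{\infty\}$. - $f(w)=1/(w+w^{ -1})$ if $q$ is even, and $f(w)=\frac14+\frac1{ -2+w+w^{ -1}}$ if $q$ is odd, for $w\neq0,1,\infty$. - $f(1)=\infty$, and $f(0)=f(\infty)$ equals $0$ ($q$ even) or $1/4$ ($q$ odd). Modified cross-ratio. - If $\ell\cap\mathcal O_{q^2}=\{P_\alpha,P_\beta\}$ and $m\cap\mathcal O_{q^2}=\{P_\gamma,P_\delta\}$, then $\hat\rho(\ell,m)=f(\rho(\alpha,\beta,\gamma,\delta))$. Auxiliary maps. - $\Delta(\ell)=xy/z^2$ if $q$ is even and $\Delta(\ell)=1/(z^2-4xy)$ if $q$ is odd, for $\ell=(z,x,y)^\perp$. - $\sigma(t)=t^2+t$ if $q$ is even and $\sigma(t)=t^2$ if $q$ is odd. -}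

module Defs where

open import Data.Nat as ℕ using (ℕ; zero; suc)
open import Data.Nat.Primality using (Prime)
open import Data.Product using (Σ; _×_; _,_; ∃)
open import Data.Sum using (_⊎_)
open import Data.Unit using (⊤)
open import Data.Empty using (⊥)
open import Relation.Nullary using (¬_; Dec; yes; no)
open import Relation.Binary.PropositionalEquality using (_≡_; _≢_)
open import Algebra.Structures using (IsCommutativeRing)

IsPrimePower : ℕ → Set
IsPrimePower q = Σ ℕ λ p → Σ ℕ λ k → Prime p × q ≡ p ℕ.^ suc k

-- Fields (with propositional equality, decidable equality, and a total
-- inverse with the convention 0⁻¹ = 0; it is only ever applied to
-- nonzero elements in the statement).

record Field : Set₁ where
  infixl 6 _+_ _-_
  infixl 7 _*_
  field
    Carrier : Set
    _+_ _*_ : Carrier → Carrier → Carrier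
    -_      : Carrier → Carrier
    _⁻¹     : Carrier → Carrier
    0# 1#   : Carrier
    isCommutativeRing : IsCommutativeRing _≡_ _+_ _*_ -_ 0# 1#
    0≢1     : 0# ≢ 1#
    ⁻¹-inverse : ∀ a → a ≢ 0# → a * (a ⁻¹) ≡ 1#
    0⁻¹≡0   : 0# ⁻¹ ≡ 0#
    _≟_     : (a b : Carrier) → Dec (a ≡ b)

  _-_ : Carrier → Carrier → Carrier
  a - b = a + (- b)

  _/_ : Carrier → Carrier → Carrier
  a / b = a * (b ⁻¹)

  2# 4# : Carrier
  2# = 1# + 1#
  4# = 2# * 2#

  _^_ : Carrier → ℕ → Carrier
  a ^ zero  = 1#
  a ^ suc n = a * (a ^ n)

-- Geometry over a field F (playing the role of F_{q^2}).

data P1 (C : Set) : Set where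
  fin : C → P1 C
  ∞   : P1 C

module _ (F : Field) where
  open Field F

  InFq : ℕ → P1 Carrier → Set
  InFq q (fin a) = a ^ q ≡ a
  InFq q ∞       = ⊤

  IsLinePG2q : ℕ → Carrier → Carrier → Carrier → Set
  IsLinePG2q q z x y =
    InFq q (fin z) × InFq q (fin x) × InFq q (fin y) ×
    ¬ (z ≡ 0# × x ≡ 0# × y ≡ 0#)

  -- P_ξ lies on the line (z,x,y)^⊥ : zX + xY + yZ = 0,
  -- with P_ξ = (ξ, ξ², 1) and P_∞ = (0,1,0).
  OnLine : Carrier → Carrier → Carrier → P1 Carrier → Set
  OnLine z x y (fin ξ) = z * ξ + x * (ξ * ξ) + y * 1# ≡ 0#
  OnLine z x y ∞       = x ≡ 0#

  -- tangent line of O (= points P_ξ with ξ ∈ F_q ∪ {∞}):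
  -- it meets O in exactly one point.
  TangentO : ℕ → Carrier → Carrier → Carrier → Set
  TangentO q z x y = Σ (P1 Carrier) λ ξ →
    InFq q ξ × OnLine z x y ξ ×
    (∀ η → InFq q η → OnLine z x y η → η ≡ ξ)

  NonTangentO : ℕ → Carrier → Carrier → Carrier → Set
  NonTangentO q z x y = ¬ TangentO q z x y

  MeetsConicIn : Carrier → Carrier → Carrier → P1 Carrier → P1 Carrier → Set
  MeetsConicIn z x y α β =
    OnLine z x y α × OnLine z x y β × α ≢ β ×
    (∀ ξ → OnLine z x y ξ → ξ ≡ α ⊎ ξ ≡ β)

  vec : P1 Carrier → Carrier × Carrier
  vec (fin a) = a , 1#
  vec ∞       = 1# , 0#

  det : P1 Carrier → P1 Carrier → Carrier
  det u v with vec u | vec v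
  ... | (a₁ , a₂) | (b₁ , b₂) = a₁ * b₂ - a₂ * b₁

  hom : Carrier → Carrier → P1 Carrier
  hom a b with b ≟ 0#
  ... | yes _ = ∞
  ... | no  _ = fin (a / b)

  ρ : P1 Carrier → P1 Carrier → P1 Carrier → P1 Carrier → P1 Carrier
  ρ α β γ δ = hom (det α γ * det β δ) (det α δ * det β γ)

  fEven : P1 Carrier → P1 Carrier
  fEven ∞ = fin 0#
  fEven (fin w) with w ≟ 0# | w ≟ 1#
  ... | yes _ | _     = fin 0#
  ... | no  _ | yes _ = ∞
  ... | no  _ | no  _ = fin ((w + w ⁻¹) ⁻¹)

  fOdd : P1 Carrier → P1 Carrier
  fOdd ∞ = fin (4# ⁻¹)
  fOdd (fin w) with w ≟ 0# | w ≟ 1#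
  ... | yes _ | _     = fin (4# ⁻¹)
  ... | no  _ | yes _ = ∞
  ... | no  _ | no  _ = fin (4# ⁻¹ + ((- 2#) + w + w ⁻¹) ⁻¹)

  ΔEven : Carrier → Carrier → Carrier → Carrier
  ΔEven z x y = (x * y) / (z * z)

  ΔOdd : Carrier → Carrier → Carrier → Carrier
  ΔOdd z x y = (z * z - 4# * x * y) ⁻¹

  σEven : Carrier → Carrier
  σEven t = t * t + t

  σOdd : Carrier → Carrier
  σOdd t = t * t

-- Give the points of O their homogeneous parameters a = (a₁ , a₂) (so P_ξ has a = (ξ , 1), P_∞ has a = (1 , 0)).
-- A line (z,x,y)^⊥ meets O where x t₁² + z t₁ t₂ + y t₂² vanishes, so a line through P_α, P_β with
-- parameters a ≠ b is (z , x , y) = k (-(a₁ b₂ + a₂ b₁) , a₂ b₂ , a₁ b₁) for some k ≠ 0; likewise m is K times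
-- the chord through c, d. With A = det(a,c) det(b,d) and B = det(a,d) det(b,c) the cross-ratio is A/B, and
-- -2 + w + w⁻¹ = (A - B)²/(AB) for w = A/B, so f(A/B) is AB/(A - B)² for q even and 1/4 + AB/(A - B)² for q odd.
-- The claimed formulas then follow from polynomial identities in the parameters: the Plücker relation
-- A - B = det(a,b) det(c,d), z² - 4xy = k² det(a,b)², 2xy' + 2x'y - zz' = kK(A + B), and, up to a multiple
-- of 2, (xy' + x'y)² + (xz' + x'z)(yz' + y'z) = (kK)² AB.
-- The parity of q decides the characteristic because |F| = q²: in characteristic 2 the translation by 1, and
-- otherwise negation with 0 paired to an added point, is a fixed-point-free involution of a set of that size.

module Submission where

open import Defs
open import Algebra.Bundles using (CommutativeRing)
open import Algebra.Definitions using (Involutive)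
import Algebra.Properties.AbelianGroup as AbelianGroupProperties
import Algebra.Properties.CommutativeSemigroup as CommutativeSemigroupProperties
import Algebra.Properties.Ring as RingProperties
import Algebra.Properties.Semiring.Mult.TCOptimised as Multiples
import Algebra.Solver.Ring
open import Algebra.Solver.Ring.AlmostCommutativeRing
  using (fromCommutativeRing; _-Raw-AlmostCommutative⟶_)
open import Data.Empty using (⊥-elim)
open import Data.Fin.Base using (Fin; zero; suc; punchIn; punchOut)
open import Data.Fin.Properties
  using (suc-injective; punchInᵢ≢i; punchIn-injective; punchIn-punchOut; 1↔⊤; +↔⊎)
open import Data.Integer.Base as ℤ using (ℤ; -[1+_]; _⊖_)
import Data.Integer.Properties as ℤ
open import Data.Maybe.Base using (Maybe; just; nothing)
open import Data.Nat.Base as ℕ using (ℕ; zero; suc) renaming (_*_ to _*ℕ_)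
open import Data.Nat.Divisibility using (_∣_; _∣0; ∣m∣n⇒∣m+n; ∣m+n∣m⇒∣n; ∣-refl; ∣1⇒≡1; ∣m⇒∣m*n)
import Data.Nat.Properties as ℕ
open import Data.Nat.Primality using (euclidsLemma; prime[2])
open import Data.Product using (_×_; _,_; proj₁; proj₂)
import Data.Sign.Base as Sign
open import Data.Sum using (_⊎_; inj₁; inj₂; [_,_])
open import Data.Sum.Properties using (inj₁-injective)
open import Data.Sum.Function.Propositional using (_⊎-↔_)
open import Data.Unit using (⊤; tt)
open import Function.Base using (_∘_)
open import Function.Bundles using (_↔_; Inverse)
open import Function.Properties.Inverse using (↔-sym; ↔-trans)
open import Relation.Nullary using (¬_; yes; no)
open import Relation.Binary.PropositionalEquality
  using (_≡_; _≢_; refl; sym; trans; cong; cong₂; module ≡-Reasoning)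

module IntegerCoefficients {c ℓ} (R : CommutativeRing c ℓ) where
  open CommutativeRing R hiding (refl; sym; trans; reflexive; setoid)
  private module ≈ = CommutativeRing R
  open RingProperties ring using (-‿distribˡ-*; -‿distribʳ-*; -0#≈0#; -‿involutive)
  open AbelianGroupProperties +-abelianGroup using (⁻¹-∙-comm; xyx⁻¹≈y)
  open Multiples semiring using (1+×; ×-homo-+; ×1-homo-*)
    renaming (_×_ to _×′_)
  open import Relation.Binary.Reasoning.Setoid ≈.setoid

  -- With the optimised multiples, 1 ×′ 1# and 2 ×′ 1# are 1# and 1# + 1# on the nose,
  -- so the solver's constants denote 1# and 2# definitionally.
  ⟦_⟧ℤ : ℤ → Carrier
  ⟦ ℤ.+ n ⟧ℤ    = n ×′ 1#
  ⟦ -[1+ n ] ⟧ℤ = - (suc n ×′ 1#)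

  private
    -x*-y≈x*y : ∀ a b → - a * - b ≈ a * b
    -x*-y≈x*y a b = begin
      - a * - b     ≈⟨ -‿distribˡ-* a (- b) ⟨
      - (a * - b)   ≈⟨ -‿cong (-‿distribʳ-* a b) ⟨
      - - (a * b)   ≈⟨ -‿involutive (a * b) ⟩
      a * b         ∎

    [x+a]-[x+b]≈a-b : ∀ x a b → (x + a) - (x + b) ≈ a - b
    [x+a]-[x+b]≈a-b x a b = begin
      (x + a) - (x + b)     ≈⟨ +-congˡ (⁻¹-∙-comm x b) ⟨
      (x + a) + (- x - b)   ≈⟨ +-assoc (x + a) (- x) (- b) ⟨
      (x + a) - x - b       ≈⟨ +-congʳ (xyx⁻¹≈y x a) ⟩
      a - b                 ∎

  ⟦⟧ℤ-⊖ : ∀ m n → ⟦ m ⊖ n ⟧ℤ ≈ m ×′ 1# - n ×′ 1#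
  ⟦⟧ℤ-⊖ zero    zero    = ≈.sym (-‿inverseʳ 0#)
  ⟦⟧ℤ-⊖ zero    (suc n) = ≈.sym (+-identityˡ _)
  ⟦⟧ℤ-⊖ (suc m) zero    = ≈.sym (≈.trans (+-congˡ -0#≈0#) (+-identityʳ _))
  ⟦⟧ℤ-⊖ (suc m) (suc n) = begin
    ⟦ suc m ⊖ suc n ⟧ℤ                ≡⟨ cong ⟦_⟧ℤ (ℤ.[1+m]⊖[1+n]≡m⊖n m n) ⟩
    ⟦ m ⊖ n ⟧ℤ                        ≈⟨ ⟦⟧ℤ-⊖ m n ⟩
    m ×′ 1# - n ×′ 1#                 ≈⟨ [x+a]-[x+b]≈a-b 1# (m ×′ 1#) (n ×′ 1#) ⟨
    (1# + m ×′ 1#) - (1# + n ×′ 1#)   ≈⟨ +-cong (1+× m 1#) (-‿cong (1+× n 1#)) ⟨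
    suc m ×′ 1# - suc n ×′ 1#         ∎

  ⟦⟧ℤ-+ : ∀ i j → ⟦ i ℤ.+ j ⟧ℤ ≈ ⟦ i ⟧ℤ + ⟦ j ⟧ℤ
  ⟦⟧ℤ-+ (ℤ.+ m)  (ℤ.+ n)  = ×-homo-+ 1# m n
  ⟦⟧ℤ-+ (ℤ.+ m)  -[1+ n ] = ⟦⟧ℤ-⊖ m (suc n)
  ⟦⟧ℤ-+ -[1+ m ] (ℤ.+ n)  = ≈.trans (⟦⟧ℤ-⊖ n (suc m)) (+-comm _ _)
  ⟦⟧ℤ-+ -[1+ m ] -[1+ n ] = begin
    - (suc (suc (m ℕ.+ n)) ×′ 1#)     ≡⟨ cong (λ k → - (suc k ×′ 1#)) (ℕ.+-suc m n) ⟨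
    - ((suc m ℕ.+ suc n) ×′ 1#)       ≈⟨ -‿cong (×-homo-+ 1# (suc m) (suc n)) ⟩
    - (suc m ×′ 1# + suc n ×′ 1#)     ≈⟨ ⁻¹-∙-comm _ _ ⟨
    - (suc m ×′ 1#) - (suc n ×′ 1#)   ∎

  ⟦⟧ℤ-neg : ∀ i → ⟦ ℤ.- i ⟧ℤ ≈ - ⟦ i ⟧ℤ
  ⟦⟧ℤ-neg (ℤ.+ zero)  = ≈.sym -0#≈0#
  ⟦⟧ℤ-neg (ℤ.+ suc n) = ≈.refl
  ⟦⟧ℤ-neg -[1+ n ]    = ≈.sym (-‿involutive _)

  ⟦⟧ℤ-* : ∀ i j → ⟦ i ℤ.* j ⟧ℤ ≈ ⟦ i ⟧ℤ * ⟦ j ⟧ℤ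
  ⟦⟧ℤ-* (ℤ.+ m)  (ℤ.+ n)  = ≈.trans (≈.reflexive (cong ⟦_⟧ℤ (ℤ.+◃n≡+n (m ℕ.* n)))) (×1-homo-* m n)
  ⟦⟧ℤ-* (ℤ.+ m)  -[1+ n ] = begin
    ⟦ Sign.- ℤ.◃ (m ℕ.* suc n) ⟧ℤ     ≡⟨ cong ⟦_⟧ℤ (ℤ.-◃n≡-n (m ℕ.* suc n)) ⟩
    ⟦ ℤ.- (ℤ.+ (m ℕ.* suc n)) ⟧ℤ      ≈⟨ ⟦⟧ℤ-neg (ℤ.+ (m ℕ.* suc n)) ⟩
    - ((m ℕ.* suc n) ×′ 1#)           ≈⟨ -‿cong (×1-homo-* m (suc n)) ⟩
    - (m ×′ 1# * suc n ×′ 1#)         ≈⟨ -‿distribʳ-* _ _ ⟩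
    m ×′ 1# * - (suc n ×′ 1#)         ∎
  ⟦⟧ℤ-* -[1+ m ] (ℤ.+ n)  = begin
    ⟦ Sign.- ℤ.◃ (suc m ℕ.* n) ⟧ℤ     ≡⟨ cong ⟦_⟧ℤ (ℤ.-◃n≡-n (suc m ℕ.* n)) ⟩
    ⟦ ℤ.- (ℤ.+ (suc m ℕ.* n)) ⟧ℤ      ≈⟨ ⟦⟧ℤ-neg (ℤ.+ (suc m ℕ.* n)) ⟩
    - ((suc m ℕ.* n) ×′ 1#)           ≈⟨ -‿cong (×1-homo-* (suc m) n) ⟩
    - (suc m ×′ 1# * n ×′ 1#)         ≈⟨ -‿distribˡ-* _ _ ⟩
    - (suc m ×′ 1#) * n ×′ 1#         ∎
  ⟦⟧ℤ-* -[1+ m ] -[1+ n ] = ≈.trans (×1-homo-* (suc m) (suc n)) (≈.sym (-x*-y≈x*y _ _))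

  ℤ⟶R : ℤ.+-*-rawRing -Raw-AlmostCommutative⟶ fromCommutativeRing R
  ℤ⟶R = record
    { ⟦_⟧    = ⟦_⟧ℤ
    ; +-homo = ⟦⟧ℤ-+
    ; *-homo = ⟦⟧ℤ-*
    ; -‿homo = ⟦⟧ℤ-neg
    ; 0-homo = ≈.refl
    ; 1-homo = ≈.refl
    }

  coefficient-equality : ∀ i j → Maybe (⟦ i ⟧ℤ ≈ ⟦ j ⟧ℤ)
  coefficient-equality i j with i ℤ.≟ j
  ... | yes refl = just ≈.refl
  ... | no _     = nothing

  open Algebra.Solver.Ring ℤ.+-*-rawRing (fromCommutativeRing R) ℤ⟶R coefficient-equality public

FixedPointFree : ∀ {a} {A : Set a} → (A → A) → Set a
FixedPointFree g = ∀ x → g x ≢ x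

fixedPointFree-involution⇒2∣n : ∀ n (h : Fin n → Fin n) →
  Involutive _≡_ h → FixedPointFree h → 2 ∣ n
fixedPointFree-involution⇒2∣n zero          h inv free = 2 ∣0
fixedPointFree-involution⇒2∣n (suc zero)    h inv free with h zero in eq
... | zero = ⊥-elim (free zero eq)
fixedPointFree-involution⇒2∣n (suc (suc m)) h inv free with h zero in h0
... | zero    = ⊥-elim (free zero h0)
... | suc p   = ∣m∣n⇒∣m+n (∣-refl {2}) (fixedPointFree-involution⇒2∣n m h′ inv′ free′)
  where
  -- h restricts to the complement of the orbit {zero , suc p}, which embed identifies with Fin m.
  embed : Fin m → Fin (suc (suc m))
  embed i = suc (punchIn p i)

  embed-injective : ∀ {i j} → embed i ≡ embed j → i ≡ j
  embed-injective = punchIn-injective p _ _ ∘ suc-injective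

  shrink : (j : Fin (suc (suc m))) → j ≢ zero → j ≢ suc p → Fin m
  shrink zero    j≢0 _   = ⊥-elim (j≢0 refl)
  shrink (suc j) _   j≢p = punchOut {i = p} {j = j} (λ p≡j → j≢p (cong suc (sym p≡j)))

  embed-shrink : ∀ j j≢0 j≢p → embed (shrink j j≢0 j≢p) ≡ j
  embed-shrink zero    j≢0 _ = ⊥-elim (j≢0 refl)
  embed-shrink (suc j) _   _ = cong suc (punchIn-punchOut _)

  h-embed≢0 : ∀ i → h (embed i) ≢ zero
  h-embed≢0 i e = punchInᵢ≢i p i (suc-injective (trans (sym (inv (embed i))) (trans (cong h e) h0)))

  h-embed≢p : ∀ i → h (embed i) ≢ suc p
  h-embed≢p i e with trans (sym (inv (embed i))) (trans (cong h e) (trans (cong h (sym h0)) (inv zero)))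
  ... | ()

  h′ : Fin m → Fin m
  h′ i = shrink (h (embed i)) (h-embed≢0 i) (h-embed≢p i)

  embed-h′ : ∀ i → embed (h′ i) ≡ h (embed i)
  embed-h′ i = embed-shrink _ _ _

  inv′ : Involutive _≡_ h′
  inv′ i = embed-injective (begin
    embed (h′ (h′ i))   ≡⟨ embed-h′ (h′ i) ⟩
    h (embed (h′ i))    ≡⟨ cong h (embed-h′ i) ⟩
    h (h (embed i))     ≡⟨ inv (embed i) ⟩
    embed i             ∎)
    where open ≡-Reasoning

  free′ : FixedPointFree h′
  free′ i e = free (embed i) (trans (sym (embed-h′ i)) (cong embed e))

fixedPointFree-involution⇒2∣card : ∀ {a} {A : Set a} {n} → A ↔ Fin n → (g : A → A) →
  Involutive _≡_ g → FixedPointFree g → 2 ∣ n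
fixedPointFree-involution⇒2∣card {n = n} A↔Fin g inv free =
  fixedPointFree-involution⇒2∣n n (to ∘ g ∘ from) inv′ free′
  where
  open Inverse A↔Fin
  inv′ : Involutive _≡_ (to ∘ g ∘ from)
  inv′ i = trans (cong (to ∘ g) (strictlyInverseʳ (g (from i))))
                 (trans (cong to (inv (from i))) (strictlyInverseˡ i))
  free′ : FixedPointFree (to ∘ g ∘ from)
  free′ i e = free (from i) (trans (sym (strictlyInverseʳ (g (from i)))) (cong from e))

module FieldProperties (F : Field) where
  open Field F public

  commutativeRing : CommutativeRing _ _
  commutativeRing = record { isCommutativeRing = isCommutativeRing }

  open CommutativeRing commutativeRing public
    using (+-assoc; +-identityˡ; +-identityʳ; -‿inverseʳ; *-assoc; *-comm; *-identityˡ; zeroˡ; zeroʳ)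
  open RingProperties (CommutativeRing.ring commutativeRing) public using (-‿involutive; -0#≈0#)
  open CommutativeSemigroupProperties (CommutativeRing.*-commutativeSemigroup commutativeRing)
    using () renaming (interchange to *-interchange)
  open IntegerCoefficients commutativeRing public using (Polynomial; solve; _:=_; con; _:+_; _:*_; _:-_; :-_)
  open ≡-Reasoning

  0ᵖ 1ᵖ 2ᵖ : ∀ {n} → Polynomial n
  0ᵖ  = con (ℤ.+ 0)
  1ᵖ  = con (ℤ.+ 1)
  2ᵖ = con (ℤ.+ 2)

  ⁻¹-inverseˡ : ∀ {x} → x ≢ 0# → x ⁻¹ * x ≡ 1#
  ⁻¹-inverseˡ x≢0 = trans (*-comm _ _) (⁻¹-inverse _ x≢0)

  *-cancelˡ-≢0 : ∀ {x y z} → x ≢ 0# → x * y ≡ x * z → y ≡ z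
  *-cancelˡ-≢0 {x} {y} {z} x≢0 xy≡xz = begin
    y                ≡⟨ unscale y ⟨
    x ⁻¹ * (x * y)   ≡⟨ cong (x ⁻¹ *_) xy≡xz ⟩
    x ⁻¹ * (x * z)   ≡⟨ unscale z ⟩
    z                ∎
    where
    unscale : ∀ w → x ⁻¹ * (x * w) ≡ w
    unscale w = begin
      x ⁻¹ * (x * w)   ≡⟨ *-assoc _ _ _ ⟨
      x ⁻¹ * x * w     ≡⟨ cong (_* w) (⁻¹-inverseˡ x≢0) ⟩
      1# * w           ≡⟨ *-identityˡ w ⟩
      w                ∎

  x*y≡0⇒x≡0⊎y≡0 : ∀ x y → x * y ≡ 0# → x ≡ 0# ⊎ y ≡ 0#
  x*y≡0⇒x≡0⊎y≡0 x y xy≡0 with x ≟ 0#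
  ... | yes x≡0 = inj₁ x≡0
  ... | no  x≢0 = inj₂ (*-cancelˡ-≢0 x≢0 (trans xy≡0 (sym (zeroʳ x))))

  x*y≢0 : ∀ {x y} → x ≢ 0# → y ≢ 0# → x * y ≢ 0#
  x*y≢0 {x} {y} x≢0 y≢0 xy≡0 = [ x≢0 , y≢0 ] (x*y≡0⇒x≡0⊎y≡0 x y xy≡0)

  ⁻¹-unique : ∀ {x y} → x * y ≡ 1# → x ⁻¹ ≡ y
  ⁻¹-unique {x} {y} xy≡1 with x ≟ 0#
  ... | yes x≡0 = ⊥-elim (0≢1 (begin
    0#       ≡⟨ zeroˡ y ⟨
    0# * y   ≡⟨ cong (_* y) x≡0 ⟨
    x * y    ≡⟨ xy≡1 ⟩
    1#       ∎))
  ... | no x≢0 = *-cancelˡ-≢0 x≢0 (trans (⁻¹-inverse x x≢0) (sym xy≡1))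

  x*y≡z⇒x≡z/y : ∀ {x y z} → y ≢ 0# → x * y ≡ z → x ≡ z / y
  x*y≡z⇒x≡z/y {x} {y} {z} y≢0 xy≡z = begin
    x                 ≡⟨ solve 1 (λ x → x := x :* 1ᵖ) refl x ⟩
    x * 1#            ≡⟨ cong (x *_) (⁻¹-inverse y y≢0) ⟨
    x * (y * y ⁻¹)    ≡⟨ *-assoc x y (y ⁻¹) ⟨
    x * y * y ⁻¹      ≡⟨ cong (_* y ⁻¹) xy≡z ⟩
    z / y             ∎

  x-y≡0⇒x≡y : ∀ {x y} → x - y ≡ 0# → x ≡ y
  x-y≡0⇒x≡y {x} {y} x-y≡0 = begin
    x               ≡⟨ solve 2 (λ x y → x := x :- y :+ y) refl x y ⟩
    x - y + y       ≡⟨ cong (_+ y) x-y≡0 ⟩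
    0# + y          ≡⟨ +-identityˡ y ⟩
    y               ∎

  ⁻¹-≢0 : ∀ {x} → x ≢ 0# → x ⁻¹ ≢ 0#
  ⁻¹-≢0 {x} x≢0 x⁻¹≡0 = 0≢1 (begin
    0#           ≡⟨ zeroʳ x ⟨
    x * 0#       ≡⟨ cong (x *_) x⁻¹≡0 ⟨
    x * x ⁻¹     ≡⟨ ⁻¹-inverse x x≢0 ⟩
    1#           ∎)

  ⁻¹-involutive : ∀ x → x ⁻¹ ⁻¹ ≡ x
  ⁻¹-involutive x with x ≟ 0#
  ... | yes refl = trans (cong _⁻¹ 0⁻¹≡0) 0⁻¹≡0
  ... | no x≢0   = ⁻¹-unique (⁻¹-inverseˡ x≢0)

  ⁻¹-distrib-* : ∀ x y → (x * y) ⁻¹ ≡ x ⁻¹ * y ⁻¹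
  ⁻¹-distrib-* x y with x ≟ 0# | y ≟ 0#
  ... | yes refl | _ = begin
    (0# * y) ⁻¹     ≡⟨ cong _⁻¹ (zeroˡ y) ⟩
    0# ⁻¹           ≡⟨ 0⁻¹≡0 ⟩
    0#              ≡⟨ zeroˡ _ ⟨
    0# * y ⁻¹       ≡⟨ cong (_* y ⁻¹) 0⁻¹≡0 ⟨
    0# ⁻¹ * y ⁻¹    ∎
  ... | no _ | yes refl = begin
    (x * 0#) ⁻¹     ≡⟨ cong _⁻¹ (zeroʳ x) ⟩
    0# ⁻¹           ≡⟨ 0⁻¹≡0 ⟩
    0#              ≡⟨ zeroʳ _ ⟨
    x ⁻¹ * 0#       ≡⟨ cong (x ⁻¹ *_) 0⁻¹≡0 ⟨
    x ⁻¹ * 0# ⁻¹    ∎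
  ... | no x≢0 | no y≢0 = ⁻¹-unique (begin
    x * y * (x ⁻¹ * y ⁻¹)     ≡⟨ *-interchange x y (x ⁻¹) (y ⁻¹) ⟩
    (x * x ⁻¹) * (y * y ⁻¹)   ≡⟨ cong₂ _*_ (⁻¹-inverse x x≢0) (⁻¹-inverse y y≢0) ⟩
    1# * 1#                   ≡⟨ *-identityˡ 1# ⟩
    1#                        ∎)

  *-/-*-cancelˡ : ∀ {c x y} → c ≢ 0# → (c * x) / (c * y) ≡ x / y
  *-/-*-cancelˡ {c} {x} {y} c≢0 = begin
    (c * x) * (c * y) ⁻¹        ≡⟨ cong ((c * x) *_) (⁻¹-distrib-* c y) ⟩
    (c * x) * (c ⁻¹ * y ⁻¹)     ≡⟨ *-interchange c x (c ⁻¹) (y ⁻¹) ⟩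
    (c * c ⁻¹) * (x * y ⁻¹)     ≡⟨ cong (_* (x * y ⁻¹)) (⁻¹-inverse c c≢0) ⟩
    1# * (x * y ⁻¹)             ≡⟨ *-identityˡ _ ⟩
    x / y                       ∎

module Characteristic (F : Field) where
  open FieldProperties F
  open ≡-Reasoning

  2#≡0#⇒2∣card : ∀ {n} → Carrier ↔ Fin n → 2# ≡ 0# → 2 ∣ n
  2#≡0#⇒2∣card F↔Fin 2≡0 = fixedPointFree-involution⇒2∣card F↔Fin (_+ 1#) inv free
    where
    inv : Involutive _≡_ (_+ 1#)
    inv x = begin
      x + 1# + 1#   ≡⟨ +-assoc x 1# 1# ⟩
      x + 2#        ≡⟨ cong (λ t → x + t) 2≡0 ⟩
      x + 0#        ≡⟨ +-identityʳ x ⟩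
      x             ∎
    free : FixedPointFree (_+ 1#)
    free x x+1≡x = 0≢1 (begin
      0#              ≡⟨ -‿inverseʳ x ⟨
      x - x           ≡⟨ cong (_- x) x+1≡x ⟨
      (x + 1#) - x    ≡⟨ solve 1 (λ x → (x :+ 1ᵖ) :- x := 1ᵖ) refl x ⟩
      1#              ∎)

  -- Negation fixes only 0; pairing 0 with an added point removes that fixed point.
  negate⁺ : Carrier ⊎ ⊤ → Carrier ⊎ ⊤
  negate⁺ (inj₂ tt) = inj₁ 0#
  negate⁺ (inj₁ x) with x ≟ 0#
  ... | yes _ = inj₂ tt
  ... | no  _ = inj₁ (- x)

  negate⁺-involutive : Involutive _≡_ negate⁺
  negate⁺-involutive (inj₂ tt) with 0# ≟ 0#
  ... | yes _   = refl
  ... | no 0≢0  = ⊥-elim (0≢0 refl)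
  negate⁺-involutive (inj₁ x) with x ≟ 0#
  ... | yes refl = refl
  ... | no x≢0 with (- x) ≟ 0#
  ...   | yes -x≡0 = ⊥-elim (x≢0 (trans (sym (-‿involutive x)) (trans (cong -_ -x≡0) -0#≈0#)))
  ...   | no  _    = cong inj₁ (-‿involutive x)

  negate⁺-fixedPointFree : 2# ≢ 0# → FixedPointFree negate⁺
  negate⁺-fixedPointFree 2≢0 (inj₂ tt) ()
  negate⁺-fixedPointFree 2≢0 (inj₁ x) fixed with x ≟ 0#
  negate⁺-fixedPointFree 2≢0 (inj₁ x) ()    | yes _
  negate⁺-fixedPointFree 2≢0 (inj₁ x) fixed | no x≢0 = x*y≢0 2≢0 x≢0 (begin
    2# * x        ≡⟨ solve 1 (λ x → 2ᵖ :* x := x :+ x) refl x ⟩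
    x + x         ≡⟨ cong (λ t → x + t) (inj₁-injective fixed) ⟨
    x - x         ≡⟨ -‿inverseʳ x ⟩
    0#            ∎)

  2#≢0#⇒2∣card+1 : ∀ {n} → Carrier ↔ Fin n → 2# ≢ 0# → 2 ∣ n ℕ.+ 1
  2#≢0#⇒2∣card+1 F↔Fin 2≢0 =
    fixedPointFree-involution⇒2∣card (↔-trans (F↔Fin ⊎-↔ ↔-sym 1↔⊤) (↔-sym +↔⊎))
      negate⁺ negate⁺-involutive (negate⁺-fixedPointFree 2≢0)

  2∣q⇒2#≡0# : ∀ q → Carrier ↔ Fin (q *ℕ q) → 2 ∣ q → 2# ≡ 0#
  2∣q⇒2#≡0# q F↔Fin 2∣q with 2# ≟ 0#
  ... | yes 2≡0 = 2≡0
  ... | no  2≢0 with ∣1⇒≡1 (∣m+n∣m⇒∣n (2#≢0#⇒2∣card+1 F↔Fin 2≢0) (∣m⇒∣m*n q 2∣q))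
  ...   | ()

  2∤q⇒2#≢0# : ∀ q → Carrier ↔ Fin (q *ℕ q) → ¬ 2 ∣ q → 2# ≢ 0#
  2∤q⇒2#≢0# q F↔Fin 2∤q 2≡0 = [ 2∤q , 2∤q ] (euclidsLemma q q prime[2] (2#≡0#⇒2∣card F↔Fin 2≡0))

module ConicChords (F : Field) where
  open FieldProperties F
  open ≡-Reasoning

  det₂ : Carrier × Carrier → Carrier × Carrier → Carrier
  det₂ (a₁ , a₂) (b₁ , b₂) = a₁ * b₂ - a₂ * b₁

  -- P_ξ lies on (z,x,y)^⊥ iff the binary form vanishes at the homogeneous parameter vec ξ of ξ.
  form : Carrier → Carrier → Carrier → Carrier × Carrier → Carrier
  form z x y (t₁ , t₂) = x * t₁ * t₁ + z * t₁ * t₂ + y * t₂ * t₂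

  polar : Carrier → Carrier → Carrier → Carrier × Carrier → Carrier × Carrier → Carrier
  polar z x y (a₁ , a₂) (b₁ , b₂) = 2# * x * a₁ * b₁ + z * (a₁ * b₂ + a₂ * b₁) + 2# * y * a₂ * b₂

  -- The coefficients of k (a₂ t₁ - a₁ t₂) (b₂ t₁ - b₁ t₂), the form vanishing exactly at a and b.
  chord : Carrier → Carrier × Carrier → Carrier × Carrier → Carrier × Carrier × Carrier
  chord k (a₁ , a₂) (b₁ , b₂) = k * - (a₁ * b₂ + a₂ * b₁) , k * (a₂ * b₂) , k * (a₁ * b₁)

  private
    Poly² : ℕ → Set
    Poly² n = Polynomial n × Polynomial n

    det₂ᵖ : ∀ {n} → Poly² n → Poly² n → Polynomial n
    det₂ᵖ (a₁ , a₂) (b₁ , b₂) = a₁ :* b₂ :- a₂ :* b₁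

    formᵖ : ∀ {n} → Polynomial n → Polynomial n → Polynomial n → Poly² n → Polynomial n
    formᵖ z x y (t₁ , t₂) = x :* t₁ :* t₁ :+ z :* t₁ :* t₂ :+ y :* t₂ :* t₂

    polarᵖ : ∀ {n} → Polynomial n → Polynomial n → Polynomial n → Poly² n → Poly² n → Polynomial n
    polarᵖ z x y (a₁ , a₂) (b₁ , b₂) =
      2ᵖ :* x :* a₁ :* b₁ :+ z :* (a₁ :* b₂ :+ a₂ :* b₁) :+ 2ᵖ :* y :* a₂ :* b₂

    chordᵖ : ∀ {n} → Polynomial n → Poly² n → Poly² n → Polynomial n × Polynomial n × Polynomial n
    chordᵖ k (a₁ , a₂) (b₁ , b₂) = k :* :- (a₁ :* b₂ :+ a₂ :* b₁) , k :* (a₂ :* b₂) , k :* (a₁ :* b₁)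

  plücker : ∀ a b c d → det₂ a c * det₂ b d - det₂ a d * det₂ b c ≡ det₂ a b * det₂ c d
  plücker (a₁ , a₂) (b₁ , b₂) (c₁ , c₂) (d₁ , d₂) =
    solve 8 (λ a₁ a₂ b₁ b₂ c₁ c₂ d₁ d₂ → let a = a₁ , a₂ ; b = b₁ , b₂ ; c = c₁ , c₂ ; d = d₁ , d₂ in
      det₂ᵖ a c :* det₂ᵖ b d :- det₂ᵖ a d :* det₂ᵖ b c := det₂ᵖ a b :* det₂ᵖ c d)
      refl a₁ a₂ b₁ b₂ c₁ c₂ d₁ d₂

  plücker≢0 : ∀ {a b c d} → det₂ a b ≢ 0# → det₂ c d ≢ 0# → det₂ a c * det₂ b d - det₂ a d * det₂ b c ≢ 0#
  plücker≢0 {a} {b} {c} {d} δ≢0 δ′≢0 A-B≡0 = x*y≢0 δ≢0 δ′≢0 (trans (sym (plücker a b c d)) A-B≡0)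

  chord-discriminant : ∀ {z x y} k a b → (z , x , y) ≡ chord k a b →
    z * z - 4# * x * y ≡ (k * det₂ a b) * (k * det₂ a b)
  chord-discriminant k (a₁ , a₂) (b₁ , b₂) refl =
    solve 5 (λ k a₁ a₂ b₁ b₂ → let a = a₁ , a₂ ; b = b₁ , b₂ ; (z , x , y) = chordᵖ k a b in
      z :* z :- 2ᵖ :* 2ᵖ :* x :* y := (k :* det₂ᵖ a b) :* (k :* det₂ᵖ a b))
      refl k a₁ a₂ b₁ b₂

  chord-pairing : ∀ {z x y z′ x′ y′} k K a b c d → (z , x , y) ≡ chord k a b → (z′ , x′ , y′) ≡ chord K c d →
    2# * x * y′ + 2# * x′ * y - z * z′ ≡ k * K * (det₂ a c * det₂ b d + det₂ a d * det₂ b c)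
  chord-pairing k K (a₁ , a₂) (b₁ , b₂) (c₁ , c₂) (d₁ , d₂) refl refl =
    solve 10 (λ k K a₁ a₂ b₁ b₂ c₁ c₂ d₁ d₂ →
      let a = a₁ , a₂ ; b = b₁ , b₂ ; c = c₁ , c₂ ; d = d₁ , d₂
          (z , x , y) = chordᵖ k a b ; (z′ , x′ , y′) = chordᵖ K c d in
      2ᵖ :* x :* y′ :+ 2ᵖ :* x′ :* y :- z :* z′ := k :* K :* (det₂ᵖ a c :* det₂ᵖ b d :+ det₂ᵖ a d :* det₂ᵖ b c))
      refl k K a₁ a₂ b₁ b₂ c₁ c₂ d₁ d₂

  chord-numerator : ∀ {z x y z′ x′ y′} k K a b c d → (z , x , y) ≡ chord k a b → (z′ , x′ , y′) ≡ chord K c d →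
    (x * y′ + x′ * y) * (x * y′ + x′ * y) + (x * z′ + x′ * z) * (y * z′ + y′ * z)
      ≡ k * K * (k * K) * (det₂ a c * det₂ b d * (det₂ a d * det₂ b c))
        + 2# * ((x * y′ + x′ * y) * z * z′ + 2# * x * y * x′ * y′)
  chord-numerator k K (a₁ , a₂) (b₁ , b₂) (c₁ , c₂) (d₁ , d₂) refl refl =
    solve 10 (λ k K a₁ a₂ b₁ b₂ c₁ c₂ d₁ d₂ →
      let a = a₁ , a₂ ; b = b₁ , b₂ ; c = c₁ , c₂ ; d = d₁ , d₂
          (z , x , y) = chordᵖ k a b ; (z′ , x′ , y′) = chordᵖ K c d
          U = x :* y′ :+ x′ :* y in
      U :* U :+ (x :* z′ :+ x′ :* z) :* (y :* z′ :+ y′ :* z)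
        := k :* K :* (k :* K) :* (det₂ᵖ a c :* det₂ᵖ b d :* (det₂ᵖ a d :* det₂ᵖ b c))
           :+ 2ᵖ :* (U :* z :* z′ :+ 2ᵖ :* x :* y :* x′ :* y′))
      refl k K a₁ a₂ b₁ b₂ c₁ c₂ d₁ d₂

  discriminant-product : ∀ k K a b c d →
    (k * det₂ a b) * (k * det₂ a b) * ((K * det₂ c d) * (K * det₂ c d))
      ≡ k * K * (k * K) * ((det₂ a c * det₂ b d - det₂ a d * det₂ b c) * (det₂ a c * det₂ b d - det₂ a d * det₂ b c))
  discriminant-product k K a b c d = begin
    (k * δ) * (k * δ) * ((K * δ′) * (K * δ′))
      ≡⟨ solve 4 (λ k K δ δ′ → (k :* δ) :* (k :* δ) :* ((K :* δ′) :* (K :* δ′))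
                                 := k :* K :* (k :* K) :* ((δ :* δ′) :* (δ :* δ′))) refl k K δ δ′ ⟩
    k * K * (k * K) * ((δ * δ′) * (δ * δ′))
      ≡⟨ cong (λ t → k * K * (k * K) * (t * t)) (plücker a b c d) ⟨
    k * K * (k * K) * (A-B * A-B)
      ∎
    where
    δ = det₂ a b
    δ′ = det₂ c d
    A-B = det₂ a c * det₂ b d - det₂ a d * det₂ b c

  chord-z²-char2 : ∀ {z x y} k a b → 2# ≡ 0# → (z , x , y) ≡ chord k a b → z * z ≡ (k * det₂ a b) * (k * det₂ a b)
  chord-z²-char2 {z} {x} {y} k a b 2≡0 line≡chord = begin
    z * z                    ≡⟨ solve 3 (λ z x y → z :* z := z :* z :- 0ᵖ :* 2ᵖ :* x :* y) refl z x y ⟩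
    z * z - 0# * 2# * x * y  ≡⟨ cong (λ t → z * z - t * 2# * x * y) 2≡0 ⟨
    z * z - 4# * x * y       ≡⟨ chord-discriminant k a b line≡chord ⟩
    (k * det₂ a b) * (k * det₂ a b) ∎

  -- The scale: form (a + b) = polar a b when form vanishes at a and b, while for chord k a b it is -k (det₂ a b)².
  form-factorisation : ∀ {z x y} a b → form z x y a ≡ 0# → form z x y b ≡ 0# → det₂ a b ≢ 0# →
    (z , x , y) ≡ chord ((- polar z x y a b) / (det₂ a b * det₂ a b)) a b
  form-factorisation {z} {x} {y} a@(a₁ , a₂) b@(b₁ , b₂) Qa≡0 Qb≡0 δ≢0 =
    cong₂ _,_ (coordinate z (- (2# * b₁ * b₂)) (- (2# * a₁ * a₂)) (- (a₁ * b₂ + a₂ * b₁))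
                 (solve 7 (λ z x y a₁ a₂ b₁ b₂ → let a = a₁ , a₂ ; b = b₁ , b₂ ; δ = det₂ᵖ a b in
                    z :* (δ :* δ) := :- (2ᵖ :* b₁ :* b₂) :* formᵖ z x y a :+ :- (2ᵖ :* a₁ :* a₂) :* formᵖ z x y b
                                       :+ :- polarᵖ z x y a b :* :- (a₁ :* b₂ :+ a₂ :* b₁))
                    refl z x y a₁ a₂ b₁ b₂))
   (cong₂ _,_ (coordinate x (b₂ * b₂) (a₂ * a₂) (a₂ * b₂)
                 (solve 7 (λ z x y a₁ a₂ b₁ b₂ → let a = a₁ , a₂ ; b = b₁ , b₂ ; δ = det₂ᵖ a b in
                    x :* (δ :* δ) := b₂ :* b₂ :* formᵖ z x y a :+ a₂ :* a₂ :* formᵖ z x y b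
                                       :+ :- polarᵖ z x y a b :* (a₂ :* b₂))
                    refl z x y a₁ a₂ b₁ b₂))
              (coordinate y (b₁ * b₁) (a₁ * a₁) (a₁ * b₁)
                 (solve 7 (λ z x y a₁ a₂ b₁ b₂ → let a = a₁ , a₂ ; b = b₁ , b₂ ; δ = det₂ᵖ a b in
                    y :* (δ :* δ) := b₁ :* b₁ :* formᵖ z x y a :+ a₁ :* a₁ :* formᵖ z x y b
                                       :+ :- polarᵖ z x y a b :* (a₁ :* b₁))
                    refl z x y a₁ a₂ b₁ b₂)))
    where
    P = polar z x y a b
    D = det₂ a b * det₂ a b
    vanish : ∀ u v e → u * form z x y a + v * form z x y b + e ≡ e
    vanish u v e = begin
      u * form z x y a + v * form z x y b + e   ≡⟨ cong₂ (λ s s′ → u * s + v * s′ + e) Qa≡0 Qb≡0 ⟩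
      u * 0# + v * 0# + e                       ≡⟨ solve 3 (λ u v e → u :* 0ᵖ :+ v :* 0ᵖ :+ e := e) refl u v e ⟩
      e                                         ∎
    coordinate : ∀ w u v t → w * D ≡ u * form z x y a + v * form z x y b + (- P) * t → w ≡ ((- P) / D) * t
    coordinate w u v t eq = begin
      w                 ≡⟨ x*y≡z⇒x≡z/y (x*y≢0 δ≢0 δ≢0) (trans eq (vanish u v _)) ⟩
      ((- P) * t) / D   ≡⟨ solve 3 (λ p t d → p :* t :* d := p :* d :* t) refl (- P) t (D ⁻¹) ⟩
      ((- P) / D) * t   ∎

  onLine⇒form≡0 : ∀ {z x y} ξ → OnLine F z x y ξ → form z x y (vec F ξ) ≡ 0#
  onLine⇒form≡0 {z} {x} {y} (fin ξ) on = begin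
    x * ξ * ξ + z * ξ * 1# + y * 1# * 1#   ≡⟨ solve 4 (λ z x y ξ →
                                                  x :* ξ :* ξ :+ z :* ξ :* 1ᵖ :+ y :* 1ᵖ :* 1ᵖ
                                                    := z :* ξ :+ x :* (ξ :* ξ) :+ y :* 1ᵖ) refl z x y ξ ⟩
    z * ξ + x * (ξ * ξ) + y * 1#           ≡⟨ on ⟩
    0#                                     ∎
  onLine⇒form≡0 {z} {x} {y} ∞ refl =
    solve 2 (λ z y →
      0ᵖ :* 1ᵖ :* 1ᵖ :+ z :* 1ᵖ :* 0ᵖ :+ y :* 0ᵖ :* 0ᵖ := 0ᵖ) refl z y

  distinct⇒det₂≢0 : ∀ {α β} → α ≢ β → det₂ (vec F α) (vec F β) ≢ 0#
  distinct⇒det₂≢0 {fin a} {fin b} α≢β δ≡0 = α≢β (cong fin (x-y≡0⇒x≡y (begin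
    a - b              ≡⟨ solve 2 (λ a b →  a :- b := a :* 1ᵖ :- 1ᵖ :* b) refl a b ⟩
    a * 1# - 1# * b    ≡⟨ δ≡0 ⟩
    0#                 ∎)))
  distinct⇒det₂≢0 {fin a} {∞}     α≢β δ≡0 = 0≢1 (begin
    0#                     ≡⟨ -0#≈0# ⟨
    - 0#                   ≡⟨ cong -_ δ≡0 ⟨
    - (a * 0# - 1# * 1#)   ≡⟨ solve 1 (λ a → :- (a :* 0ᵖ :- 1ᵖ :* 1ᵖ) := 1ᵖ) refl a ⟩
    1#                     ∎)
  distinct⇒det₂≢0 {∞}     {fin b} α≢β δ≡0 = 0≢1 (begin
    0#                 ≡⟨ δ≡0 ⟨
    1# * 1# - 0# * b   ≡⟨ solve 1 (λ b → 1ᵖ :* 1ᵖ :- 0ᵖ :* b := 1ᵖ) refl b ⟩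
    1#                 ∎)
  distinct⇒det₂≢0 {∞}     {∞}     α≢β _   = α≢β refl

  chord-scale≢0 : ∀ {z x y k} a b → ¬ (z ≡ 0# × x ≡ 0# × y ≡ 0#) → (z , x , y) ≡ chord k a b → k ≢ 0#
  chord-scale≢0 _ _ nonzero refl refl = nonzero (zeroˡ _ , zeroˡ _ , zeroˡ _)

  record Chord (z x y : Carrier) (a b : Carrier × Carrier) : Set where
    field
      endpoints-distinct : det₂ a b ≢ 0#
      scale              : Carrier
      scale≢0            : scale ≢ 0#
      coordinates        : (z , x , y) ≡ chord scale a b

  chord-through : ∀ {z x y α β} → ¬ (z ≡ 0# × x ≡ 0# × y ≡ 0#) → MeetsConicIn F z x y α β →
    Chord z x y (vec F α) (vec F β)
  chord-through {α = α} {β} nonzero (onα , onβ , α≢β , _) = record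
    { endpoints-distinct = δ≢0
    ; scale              = _
    ; scale≢0            = chord-scale≢0 (vec F α) (vec F β) nonzero line≡chord
    ; coordinates        = line≡chord
    }
    where
    δ≢0 = distinct⇒det₂≢0 α≢β
    line≡chord = form-factorisation (vec F α) (vec F β) (onLine⇒form≡0 α onα) (onLine⇒form≡0 β onβ) δ≢0

  chord-z≢0-char2 : ∀ {z x y a b} → 2# ≡ 0# → Chord z x y a b → z ≢ 0#
  chord-z≢0-char2 {z} {a = a} {b} 2≡0 ℓ z≡0 =
    x*y≢0 kδ≢0 kδ≢0 (begin
      (ℓ.scale * det₂ a b) * (ℓ.scale * det₂ a b)   ≡⟨ chord-z²-char2 ℓ.scale a b 2≡0 ℓ.coordinates ⟨
      z * z                                         ≡⟨ cong (z *_) z≡0 ⟩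
      z * 0#                                        ≡⟨ zeroʳ z ⟩
      0#                                            ∎)
    where
    module ℓ = Chord ℓ
    kδ≢0 = x*y≢0 ℓ.scale≢0 ℓ.endpoints-distinct

module CrossRatioFunctions (F : Field) where
  open FieldProperties F
  open ≡-Reasoning

  /≡1⇒≡ : ∀ {x y} → y ≢ 0# → x / y ≡ 1# → x ≡ y
  /≡1⇒≡ {x} {y} y≢0 x/y≡1 = begin
    x                   ≡⟨ solve 1 (λ x → x := x :* 1ᵖ) refl x ⟩
    x * 1#              ≡⟨ cong (x *_) (⁻¹-inverseˡ y≢0) ⟨
    x * (y ⁻¹ * y)      ≡⟨ *-assoc x (y ⁻¹) y ⟨
    x / y * y           ≡⟨ cong (_* y) x/y≡1 ⟩
    1# * y              ≡⟨ *-identityˡ y ⟩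
    y                   ∎

  ratio-shift : ∀ {A B} → A ≢ 0# → B ≢ 0# →
    (- 2#) + A / B + (A / B) ⁻¹ ≡ ((A - B) * (A - B)) / (A * B)
  ratio-shift {A} {B} A≢0 B≢0 = begin
    (- 2#) + A / B + (A / B) ⁻¹
      ≡⟨ cong (λ t → (- 2#) + A / B + t) inverse-ratio ⟩
    (- 2#) + A * B ⁻¹ + A ⁻¹ * B
      ≡⟨ solve 4 (λ A B A′ B′ → :- 2ᵖ :+ A :* B′ :+ A′ :* B
                                  := A :* 1ᵖ :* B′ :- 2ᵖ :* 1ᵖ :* 1ᵖ :+ B :* 1ᵖ :* A′)
           refl A B (A ⁻¹) (B ⁻¹) ⟩
    G 1# 1#
      ≡⟨ cong₂ G (⁻¹-inverse A A≢0) (⁻¹-inverse B B≢0) ⟨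
    G (A * A ⁻¹) (B * B ⁻¹)
      ≡⟨ solve 4 (λ A B A′ B′ → A :* (A :* A′) :* B′ :- 2ᵖ :* (A :* A′) :* (B :* B′) :+ B :* (B :* B′) :* A′
                                  := (A :- B) :* (A :- B) :* (A′ :* B′))
           refl A B (A ⁻¹) (B ⁻¹) ⟩
    (A - B) * (A - B) * (A ⁻¹ * B ⁻¹)
      ≡⟨ cong ((A - B) * (A - B) *_) (⁻¹-distrib-* A B) ⟨
    ((A - B) * (A - B)) / (A * B)
      ∎
    where
    inverse-ratio : (A / B) ⁻¹ ≡ A ⁻¹ * B
    inverse-ratio = trans (⁻¹-distrib-* A (B ⁻¹)) (cong (A ⁻¹ *_) (⁻¹-involutive B))
    -- The solver sees A ⁻¹ and B ⁻¹ as free atoms, so the cancellations A * A ⁻¹ = 1 = B * B ⁻¹ are made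
    -- explicit by G; the same device is used in the identities of ModifiedCrossRatio.
    G : Carrier → Carrier → Carrier
    G p q = A * p * B ⁻¹ - 2# * p * q + B * q * A ⁻¹

  ratio-shift⁻¹ : ∀ {A B} → A ≢ 0# → B ≢ 0# →
    ((- 2#) + A / B + (A / B) ⁻¹) ⁻¹ ≡ (A * B) / ((A - B) * (A - B))
  ratio-shift⁻¹ {A} {B} A≢0 B≢0 = begin
    ((- 2#) + A / B + (A / B) ⁻¹) ⁻¹           ≡⟨ cong _⁻¹ (ratio-shift A≢0 B≢0) ⟩
    ((A - B) * (A - B) * (A * B) ⁻¹) ⁻¹        ≡⟨ ⁻¹-distrib-* _ _ ⟩
    ((A - B) * (A - B)) ⁻¹ * (A * B) ⁻¹ ⁻¹     ≡⟨ cong (((A - B) * (A - B)) ⁻¹ *_) (⁻¹-involutive (A * B)) ⟩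
    ((A - B) * (A - B)) ⁻¹ * (A * B)           ≡⟨ *-comm _ _ ⟩
    (A * B) / ((A - B) * (A - B))              ∎

  f∘hom : (f : P1 Carrier → P1 Carrier) (c : Carrier) →
    f ∞ ≡ fin c → f (fin 0#) ≡ fin c →
    (∀ w → w ≢ 0# → w ≢ 1# → f (fin w) ≡ fin (c + ((- 2#) + w + w ⁻¹) ⁻¹)) →
    ∀ A B → A - B ≢ 0# → f (hom F A B) ≡ fin (c + (A * B) / ((A - B) * (A - B)))
  f∘hom f c f∞ f0 fw A B A-B≢0 with B ≟ 0#
  ... | yes refl = trans f∞ (cong fin (solve 3 (λ c A e → c := c :+ A :* 0ᵖ :* e) refl c A _))
  ... | no B≢0 with A ≟ 0#
  ...   | yes refl = begin
    f (fin (0# / B))     ≡⟨ cong (f ∘ fin) (zeroˡ _) ⟩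
    f (fin 0#)           ≡⟨ f0 ⟩
    fin c                ≡⟨ cong fin (solve 3 (λ c B e → c := c :+ 0ᵖ :* B :* e) refl c B _) ⟩
    fin (c + (0# * B) / ((0# - B) * (0# - B)))  ∎
  ...   | no A≢0 = begin
    f (fin (A / B))                                    ≡⟨ fw (A / B) (x*y≢0 A≢0 (⁻¹-≢0 B≢0)) (A-B≢0 ∘ A/B≡1⇒A-B≡0) ⟩
    fin (c + ((- 2#) + A / B + (A / B) ⁻¹) ⁻¹)          ≡⟨ cong (λ t → fin (c + t)) (ratio-shift⁻¹ A≢0 B≢0) ⟩
    fin (c + (A * B) / ((A - B) * (A - B)))            ∎
    where
    A/B≡1⇒A-B≡0 : A / B ≡ 1# → A - B ≡ 0#
    A/B≡1⇒A-B≡0 A/B≡1 = trans (cong (_- B) (/≡1⇒≡ B≢0 A/B≡1)) (-‿inverseʳ B)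

  fEven-hom : 2# ≡ 0# → ∀ A B → A - B ≢ 0# → fEven F (hom F A B) ≡ fin ((A * B) / ((A - B) * (A - B)))
  fEven-hom 2≡0 A B A-B≢0 =
    trans (f∘hom (fEven F) 0# refl fEven-0 fEven-w A B A-B≢0) (cong fin (+-identityˡ _))
    where
    fEven-0 : fEven F (fin 0#) ≡ fin 0#
    fEven-0 with 0# ≟ 0#
    ... | yes _   = refl
    ... | no 0≢0  = ⊥-elim (0≢0 refl)
    fEven-w : ∀ w → w ≢ 0# → w ≢ 1# → fEven F (fin w) ≡ fin (0# + ((- 2#) + w + w ⁻¹) ⁻¹)
    fEven-w w w≢0 w≢1 with w ≟ 0# | w ≟ 1#
    ... | yes w≡0 | _       = ⊥-elim (w≢0 w≡0)
    ... | no _    | yes w≡1 = ⊥-elim (w≢1 w≡1)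
    ... | no _    | no _    = cong fin (begin
      (w + w ⁻¹) ⁻¹                    ≡⟨ cong _⁻¹ (solve 2 (λ w w′ → w :+ w′ := 0ᵖ :+ w :+ w′) refl w (w ⁻¹)) ⟩
      (0# + w + w ⁻¹) ⁻¹               ≡⟨ cong (λ t → (t + w + w ⁻¹) ⁻¹) (trans (sym -0#≈0#) (cong -_ (sym 2≡0))) ⟩
      ((- 2#) + w + w ⁻¹) ⁻¹           ≡⟨ +-identityˡ _ ⟨
      0# + ((- 2#) + w + w ⁻¹) ⁻¹      ∎)

  fOdd-hom : ∀ A B → A - B ≢ 0# → fOdd F (hom F A B) ≡ fin (4# ⁻¹ + (A * B) / ((A - B) * (A - B)))
  fOdd-hom = f∘hom (fOdd F) (4# ⁻¹) refl fOdd-0 fOdd-w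
    where
    fOdd-0 : fOdd F (fin 0#) ≡ fin (4# ⁻¹)
    fOdd-0 with 0# ≟ 0#
    ... | yes _   = refl
    ... | no 0≢0  = ⊥-elim (0≢0 refl)
    fOdd-w : ∀ w → w ≢ 0# → w ≢ 1# → fOdd F (fin w) ≡ fin (4# ⁻¹ + ((- 2#) + w + w ⁻¹) ⁻¹)
    fOdd-w w w≢0 w≢1 with w ≟ 0# | w ≟ 1#
    ... | yes w≡0 | _       = ⊥-elim (w≢0 w≡0)
    ... | no _    | yes w≡1 = ⊥-elim (w≢1 w≡1)
    ... | no _    | no _    = refl

module ModifiedCrossRatio (F : Field) where
  open FieldProperties F
  open ConicChords F
  open CrossRatioFunctions F
  open ≡-Reasoning

  σEven-identity : ∀ {z x y z′ x′ y′} → z ≢ 0# → z′ ≢ 0# →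
    ((x * y′ + x′ * y) * (x * y′ + x′ * y) + (x * z′ + x′ * z) * (y * z′ + y′ * z)) / (z * z * z′ * z′)
      ≡ σEven F ((x * y′ + x′ * y) / (z * z′)) + ΔEven F z x y + ΔEven F z′ x′ y′
  σEven-identity {z} {x} {y} {z′} {x′} {y′} z≢0 z′≢0 = begin
    N * (z * z * z′ * z′) ⁻¹
      ≡⟨ cong (N *_) z⁴⁻¹ ⟩
    N * (w * w * w′ * w′)
      ≡⟨ solve 8 (λ z x y z′ x′ y′ w w′ → let U = x :* y′ :+ x′ :* y in
           (U :* U :+ (x :* z′ :+ x′ :* z) :* (y :* z′ :+ y′ :* z)) :* (w :* w :* w′ :* w′)
             := U :* U :* (w :* w :* w′ :* w′) :+ U :* (w :* w′) :* (z :* w) :* (z′ :* w′)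
                :+ x :* y :* (w :* w) :* ((z′ :* w′) :* (z′ :* w′))
                :+ x′ :* y′ :* (w′ :* w′) :* ((z :* w) :* (z :* w)))
           refl z x y z′ x′ y′ w w′ ⟩
    G (z * w) (z′ * w′)
      ≡⟨ cong₂ G (⁻¹-inverse z z≢0) (⁻¹-inverse z′ z′≢0) ⟩
    G 1# 1#
      ≡⟨ solve 7 (λ U x y x′ y′ w w′ →
           U :* U :* (w :* w :* w′ :* w′) :+ U :* (w :* w′) :* 1ᵖ :* 1ᵖ
             :+ x :* y :* (w :* w) :* (1ᵖ :* 1ᵖ) :+ x′ :* y′ :* (w′ :* w′) :* (1ᵖ :* 1ᵖ)
           := (U :* (w :* w′)) :* (U :* (w :* w′)) :+ U :* (w :* w′) :+ x :* y :* (w :* w) :+ x′ :* y′ :* (w′ :* w′))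
           refl U x y x′ y′ w w′ ⟩
    H (w * w′) (w * w) (w′ * w′)
      ≡⟨ cong₂ (λ s t → H s (proj₁ t) (proj₂ t))
           (⁻¹-distrib-* z z′) (cong₂ _,_ (⁻¹-distrib-* z z) (⁻¹-distrib-* z′ z′)) ⟨
    H ((z * z′) ⁻¹) ((z * z) ⁻¹) ((z′ * z′) ⁻¹)
      ∎
    where
    U = x * y′ + x′ * y
    N = U * U + (x * z′ + x′ * z) * (y * z′ + y′ * z)
    w = z ⁻¹
    w′ = z′ ⁻¹
    z⁴⁻¹ : (z * z * z′ * z′) ⁻¹ ≡ w * w * w′ * w′
    z⁴⁻¹ = begin
      (z * z * z′ * z′) ⁻¹   ≡⟨ ⁻¹-distrib-* (z * z * z′) z′ ⟩
      (z * z * z′) ⁻¹ * w′   ≡⟨ cong (_* w′) (⁻¹-distrib-* (z * z) z′) ⟩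
      (z * z) ⁻¹ * w′ * w′   ≡⟨ cong (λ t → t * w′ * w′) (⁻¹-distrib-* z z) ⟩
      w * w * w′ * w′        ∎
    G : Carrier → Carrier → Carrier
    G p p′ = U * U * (w * w * w′ * w′) + U * (w * w′) * p * p′
             + x * y * (w * w) * (p′ * p′) + x′ * y′ * (w′ * w′) * (p * p)
    H : Carrier → Carrier → Carrier → Carrier
    H s t t′ = (U * s) * (U * s) + U * s + x * y * t + x′ * y′ * t′

  σOdd-identity : ∀ {z x y z′ x′ y′ Δ Δ′} → 2# ≢ 0# →
    ((2# * x * y′ + 2# * x′ * y - z * z′) * (2# * x * y′ + 2# * x′ * y - z * z′) * Δ * Δ′) / 4#
      ≡ σOdd F (x * y′ + x′ * y - (z * z′) / 2#) * Δ * Δ′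
  σOdd-identity {z} {x} {y} {z′} {x′} {y′} {Δ} {Δ′} 2≢0 = begin
    T * T * Δ * Δ′ * (2# * 2#) ⁻¹
      ≡⟨ cong (T * T * Δ * Δ′ *_) (⁻¹-distrib-* 2# 2#) ⟩
    T * T * Δ * Δ′ * (h * h)
      ≡⟨ solve 9 (λ z x y z′ x′ y′ h Δ Δ′ →
           let T = 2ᵖ :* x :* y′ :+ 2ᵖ :* x′ :* y :- z :* z′ ; U = x :* y′ :+ x′ :* y in
           T :* T :* Δ :* Δ′ :* (h :* h)
             := (U :* (2ᵖ :* h) :- z :* z′ :* h) :* (U :* (2ᵖ :* h) :- z :* z′ :* h) :* Δ :* Δ′)
           refl z x y z′ x′ y′ h Δ Δ′ ⟩
    G (2# * h)
      ≡⟨ cong G (⁻¹-inverse 2# 2≢0) ⟩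
    G 1#
      ≡⟨ solve 5 (λ U zz′ h Δ Δ′ → (U :* 1ᵖ :- zz′ :* h) :* (U :* 1ᵖ :- zz′ :* h) :* Δ :* Δ′
                                     := (U :- zz′ :* h) :* (U :- zz′ :* h) :* Δ :* Δ′)
           refl U (z * z′) h Δ Δ′ ⟩
    σOdd F (U - (z * z′) / 2#) * Δ * Δ′
      ∎
    where
    T = 2# * x * y′ + 2# * x′ * y - z * z′
    U = x * y′ + x′ * y
    h = 2# ⁻¹
    G : Carrier → Carrier
    G p = (U * p - z * z′ * h) * (U * p - z * z′ * h) * Δ * Δ′

  quarter-identity : ∀ {A B} → 2# ≢ 0# → A - B ≢ 0# →
    4# ⁻¹ + (A * B) / ((A - B) * (A - B)) ≡ ((A + B) * (A + B)) / ((A - B) * (A - B)) * 4# ⁻¹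
  quarter-identity {A} {B} 2≢0 A-B≢0 = begin
    i + (A * B) * e
      ≡⟨ solve 4 (λ i A B e → i :+ (A :* B) :* e := 1ᵖ :* i :+ 1ᵖ :* (A :* B :* e)) refl i A B e ⟩
    G 1# 1#
      ≡⟨ cong₂ G (⁻¹-inverse E (x*y≢0 A-B≢0 A-B≢0)) (⁻¹-inverse 4# (x*y≢0 2≢0 2≢0)) ⟨
    G (E * e) (4# * i)
      ≡⟨ solve 4 (λ i A B e → let E = (A :- B) :* (A :- B) in
           E :* e :* i :+ 2ᵖ :* 2ᵖ :* i :* (A :* B :* e) := (A :+ B) :* (A :+ B) :* e :* i)
           refl i A B e ⟩
    (A + B) * (A + B) * e * i
      ∎
    where
    E = (A - B) * (A - B)
    e = E ⁻¹
    i = 4# ⁻¹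
    G : Carrier → Carrier → Carrier
    G p q = p * i + q * (A * B * e)

  fEven-cross-ratio : ∀ {z x y z′ x′ y′ a b c d} → 2# ≡ 0# → Chord z x y a b → Chord z′ x′ y′ c d →
    fEven F (hom F (det₂ a c * det₂ b d) (det₂ a d * det₂ b c))
      ≡ fin (((x * y′ + x′ * y) * (x * y′ + x′ * y) + (x * z′ + x′ * z) * (y * z′ + y′ * z)) / (z * z * z′ * z′))
  fEven-cross-ratio {z} {x} {y} {z′} {x′} {y′} {a} {b} {c} {d} 2≡0 ℓ m = begin
    fEven F (hom F A B)             ≡⟨ fEven-hom 2≡0 A B (plücker≢0 ℓ.endpoints-distinct m.endpoints-distinct) ⟩
    fin ((A * B) / E)               ≡⟨ cong fin (*-/-*-cancelˡ (x*y≢0 kK≢0 kK≢0)) ⟨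
    fin ((κ * (A * B)) / (κ * E))   ≡⟨ cong fin (cong₂ _/_ numerator denominator) ⟨
    fin (N / (z * z * z′ * z′))     ∎
    where
    module ℓ = Chord ℓ
    module m = Chord m
    k = ℓ.scale
    K = m.scale
    kK≢0 = x*y≢0 ℓ.scale≢0 m.scale≢0
    κ = k * K * (k * K)
    A = det₂ a c * det₂ b d
    B = det₂ a d * det₂ b c
    E = (A - B) * (A - B)
    U = x * y′ + x′ * y
    N = U * U + (x * z′ + x′ * z) * (y * z′ + y′ * z)
    R = U * z * z′ + 2# * x * y * x′ * y′
    numerator : N ≡ κ * (A * B)
    numerator = begin
      N                        ≡⟨ chord-numerator k K a b c d ℓ.coordinates m.coordinates ⟩
      κ * (A * B) + 2# * R     ≡⟨ cong (λ t → κ * (A * B) + t * R) 2≡0 ⟩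
      κ * (A * B) + 0# * R     ≡⟨ solve 2 (λ s r → s :+ 0ᵖ :* r := s) refl (κ * (A * B)) R ⟩
      κ * (A * B)              ∎
    denominator : z * z * z′ * z′ ≡ κ * E
    denominator = begin
      z * z * z′ * z′
        ≡⟨ *-assoc (z * z) z′ z′ ⟩
      z * z * (z′ * z′)
        ≡⟨ cong₂ _*_ (chord-z²-char2 k a b 2≡0 ℓ.coordinates) (chord-z²-char2 K c d 2≡0 m.coordinates) ⟩
      (k * det₂ a b) * (k * det₂ a b) * ((K * det₂ c d) * (K * det₂ c d))
        ≡⟨ discriminant-product k K a b c d ⟩
      κ * E
        ∎

  fOdd-cross-ratio : ∀ {z x y z′ x′ y′ a b c d} → 2# ≢ 0# → Chord z x y a b → Chord z′ x′ y′ c d →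
    fOdd F (hom F (det₂ a c * det₂ b d) (det₂ a d * det₂ b c))
      ≡ fin (((2# * x * y′ + 2# * x′ * y - z * z′) * (2# * x * y′ + 2# * x′ * y - z * z′)
               * ΔOdd F z x y * ΔOdd F z′ x′ y′) / 4#)
  fOdd-cross-ratio {z} {x} {y} {z′} {x′} {y′} {a} {b} {c} {d} 2≢0 ℓ m = begin
    fOdd F (hom F A B)                      ≡⟨ fOdd-hom A B A-B≢0 ⟩
    fin (4# ⁻¹ + (A * B) / E)               ≡⟨ cong fin (quarter-identity 2≢0 A-B≢0) ⟩
    fin (((A + B) * (A + B)) / E * 4# ⁻¹)   ≡⟨ cong (λ t → fin (t * 4# ⁻¹)) scaled ⟨
    fin (T * T * Δ * Δ′ * 4# ⁻¹)            ∎
    where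
    module ℓ = Chord ℓ
    module m = Chord m
    k = ℓ.scale
    K = m.scale
    kK≢0 = x*y≢0 ℓ.scale≢0 m.scale≢0
    κ = k * K * (k * K)
    A = det₂ a c * det₂ b d
    B = det₂ a d * det₂ b c
    E = (A - B) * (A - B)
    A-B≢0 = plücker≢0 ℓ.endpoints-distinct m.endpoints-distinct
    T = 2# * x * y′ + 2# * x′ * y - z * z′
    Δ = ΔOdd F z x y
    Δ′ = ΔOdd F z′ x′ y′
    ΔΔ′ : Δ * Δ′ ≡ (κ * E) ⁻¹
    ΔΔ′ = begin
      Δ * Δ′
        ≡⟨ cong₂ (λ s t → s ⁻¹ * t ⁻¹)
             (chord-discriminant k a b ℓ.coordinates) (chord-discriminant K c d m.coordinates) ⟩
      ((k * det₂ a b) * (k * det₂ a b)) ⁻¹ * ((K * det₂ c d) * (K * det₂ c d)) ⁻¹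
        ≡⟨ ⁻¹-distrib-* _ _ ⟨
      ((k * det₂ a b) * (k * det₂ a b) * ((K * det₂ c d) * (K * det₂ c d))) ⁻¹
        ≡⟨ cong _⁻¹ (discriminant-product k K a b c d) ⟩
      (κ * E) ⁻¹
        ∎
    scaled : T * T * Δ * Δ′ ≡ ((A + B) * (A + B)) / E
    scaled = begin
      T * T * Δ * Δ′
        ≡⟨ *-assoc (T * T) Δ Δ′ ⟩
      T * T * (Δ * Δ′)
        ≡⟨ cong₂ (λ s t → s * s * t) (chord-pairing k K a b c d ℓ.coordinates m.coordinates) ΔΔ′ ⟩
      (k * K * (A + B)) * (k * K * (A + B)) * (κ * E) ⁻¹
        ≡⟨ cong (_* (κ * E) ⁻¹) (solve 3 (λ k K S → (k :* K :* S) :* (k :* K :* S) := k :* K :* (k :* K) :* (S :* S))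
                                           refl k K (A + B)) ⟩
      (κ * ((A + B) * (A + B))) / (κ * E)
        ≡⟨ *-/-*-cancelˡ (x*y≢0 kK≢0 kK≢0) ⟩
      ((A + B) * (A + B)) / E
        ∎

mainTheorem11 :
  (q : ℕ) → IsPrimePower q →
  (F : Field) → (Field.Carrier F ↔ Fin (q *ℕ q)) →
  (z x y z' x' y' : Field.Carrier F) →
  IsLinePG2q F q z x y → IsLinePG2q F q z' x' y' →
  NonTangentO F q z x y → NonTangentO F q z' x' y' →
  (α β γ δ : P1 (Field.Carrier F)) →
  MeetsConicIn F z x y α β → MeetsConicIn F z' x' y' γ δ →
  let open Field F in
  (2 ∣ q →
     (fEven F (ρ F α β γ δ)
        ≡ fin (((x * y' + x' * y) * (x * y' + x' * y)
                 + (x * z' + x' * z) * (y * z' + y' * z))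
                / (z * z * z' * z'))
      × ((x * y' + x' * y) * (x * y' + x' * y)
                 + (x * z' + x' * z) * (y * z' + y' * z))
                / (z * z * z' * z')
        ≡ σEven F ((x * y' + x' * y) / (z * z'))
          + ΔEven F z x y + ΔEven F z' x' y'))
  ×
  (¬ (2 ∣ q) →
     (fOdd F (ρ F α β γ δ)
        ≡ fin (((2# * x * y' + 2# * x' * y - z * z')
                 * (2# * x * y' + 2# * x' * y - z * z')
                 * ΔOdd F z x y * ΔOdd F z' x' y') / 4#)
      × ((2# * x * y' + 2# * x' * y - z * z')
                 * (2# * x * y' + 2# * x' * y - z * z')
                 * ΔOdd F z x y * ΔOdd F z' x' y') / 4#
        ≡ σOdd F (x * y' + x' * y - (z * z') / 2#)
          * ΔOdd F z x y * ΔOdd F z' x' y'))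
mainTheorem11 q _ F F↔Fin z x y z' x' y' (_ , _ , _ , ℓ≢0) (_ , _ , _ , m≢0) _ _ α β γ δ ℓ∩O m∩O =
  (λ 2∣q → let 2≡0 = 2∣q⇒2#≡0# q F↔Fin 2∣q in
      fEven-cross-ratio 2≡0 ℓ m , σEven-identity (chord-z≢0-char2 2≡0 ℓ) (chord-z≢0-char2 2≡0 m))
  ,
  (λ 2∤q → let 2≢0 = 2∤q⇒2#≢0# q F↔Fin 2∤q in
      fOdd-cross-ratio 2≢0 ℓ m , σOdd-identity 2≢0)
  where
  open Characteristic F
  open ConicChords F
  open ModifiedCrossRatio F
  ℓ = chord-through ℓ≢0 ℓ∩O
  m = chord-through m≢0 m∩O
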